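{- Let $A=\langle S,\Sigma\cup\{\tau\},E,s_0\rangle$ and $A'=\langle S',\Sigma_{\mathcal{F}}\cup\{\tau\},E',s_0'\rangle$ be transition systems. Then $A\preceq^w_m A'$ if and only if the verifier has a winning strategy in the weak masking game graph $\mathcal{G}^W_{A^M,A'}$.
   Context: A transition system is a tuple $\langle S,\Sigma,E,s_0\rangle$ with $S$ finite, $\Sigma$ a finite alphabet, $E\subseteq S\times\Sigma\times S$ (written $s\xrightarrow{e}t$), $s_0\in S$; every state has an outgoing transition. $\tau$ is the silent action. $\mathcal{F}=\{F_0,\dots,F_n\}$ is a finite set of fault labels disjoint from $\Sigma\cup\{\tau\}$, $\Sigma_{\mathcal{F}}=\Sigma\cup\mathcal{F}$; $M$ is a fresh masking label and $A^M$ is $A$ with an added self-loop $s\xrightarrow{M}s$ at every state. Weak transitions: for $e\neq\tau$ an ordinary label, $\xRightarrow{e}=(\xrightarrow{\tau})^*\circ\xrightarrow{e}\circ(\xrightarrow{\tau})^*$; $\xRightarrow{\tau}=(\xrightarrow{\tau})^*$; for $e\in\{M\}\cup\mathcal{F}$, $\xRightarrow{e}=\xrightarrow{e}$. Weak masking simulation: $A\preceq^w_m A'$ iff there is $\mathcal{M}\subseteq S\times S'$ with (A) $s_0\,\mathcal{M}\,s_0'$, and (B) for all $s\,\mathcal{M}\,s'$ and $e\in\Sigma\cup\{\tau\}$: (1) if $s\xrightarrow{e}t$ in $A$ then some $s'\xRightarrow{e}t'$ in $A'$ with $t\,\mathcal{M}\,t'$; (2) if $s'\xrightarrow{e}t'$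 in $A'$ then some $s\xRightarrow{e}t$ in $A$ with $t\,\mathcal{M}\,t'$; (3) if $s'\xrightarrow{F}t'$ in $A'$, $F\in\mathcal{F}$, then some $s\xrightarrow{M}t$ in $A^M$ with $t\,\mathcal{M}\,t'$. Weak masking game graph $\mathcal{G}^W_{A^M,A'}$ (players refuter $R$ and verifier $V$): refuter nodes $(s,\#,s',R)$ ($s\in S,s'\in S'$) plus an error node $s_{err}$; verifier nodes $(s,\sigma^k,s',V)$, $k\in\{1,2\}$, $\sigma$ a label. Initial node $(s_0,\#,s_0',R)$. Edges: $(s,\#,s',R)\xrightarrow{\sigma}(t,\sigma^1,s',V)$ if $\sigma\in\Sigma\cup\{\tau\}$ and $s\xRightarrow{\sigma}t$ in $A$; $(s,\#,s',R)\xrightarrow{\sigma}(s,\sigma^2,t',V)$ if $\sigma\in\Sigma_{\mathcal{F}}\cup\{\tau\}$ and $s'\xRightarrow{\sigma}t'$ in $A'$; $(s,\sigma^2,s',V)\xrightarrow{\sigma}(t,\#,s',R)$ if $\sigma\in\Sigma\cup\{\tau\}$ and $s\xRightarrow{\sigma}t$ in $A$; $(s,\sigma^1,s',V)\xrightarrow{\sigma}(s,\#,t',R)$ if $\sigma\in\Sigma\cup\{\tau\}$ and $s'\xRightarrow{\sigma}t'$ in $A'$; $(s,F^2,s',V)\xrightarrow{M}(t,\#,s',R)$ if $F\in\mathcal{F}$ and $s\xrightarrow{M}t$ in $A^M$; every node without outgoing edges gets edges to $s_{err}$, which has self-loops. Plays are infinite paths from the initial node; strategies map finite prefixes ending in the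 player's node to an outgoing edge. The refuter wins a play iff it visits $s_{err}$; a winning strategy is one all of whose conforming plays are won. -}

module Defs where

open import Data.Nat using (ℕ; suc; zero)
open import Data.Fin using (Fin)
open import Data.Bool using (Bool; true)
open import Data.Product using (Σ; ∃; _×_; _,_; proj₁; proj₂)
open import Data.Empty using (⊥)
open import Relation.Nullary using (¬_)
open import Relation.Binary.PropositionalEquality using (_≡_; _≢_; subst; sym)
open import Relation.Binary.Construct.Closure.ReflexiveTransitive using (Star)

data Act (nΣ : ℕ) : Set where
  act : Fin nΣ → Act nΣ
  tau : Act nΣ

-- Labels  Σ_F ∪ {τ} = Σ ∪ F ∪ {τ}  with fault labels F = Fin nF
-- (disjoint from Σ ∪ {τ} by construction).
data FLab (nΣ nF : ℕ) : Set where
  ord : Act nΣ → FLab nΣ nF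
  flt : Fin nF → FLab nΣ nF

record TS (L : Set) : Set where
  field
    nS    : ℕ
    E     : Fin nS → L → Fin nS → Bool
    s₀    : Fin nS
    total : (s : Fin nS) → Σ L λ e → Σ (Fin nS) λ t → E s e t ≡ true

open TS public

Step : {L : Set} (A : TS L) → L → Fin (nS A) → Fin (nS A) → Set
Step A e s t = E A s e t ≡ true

-- weak transitions for ordinary labels; ι embeds Σ ∪ {τ} into the label set
TauStar : {nΣ : ℕ} {L : Set} (A : TS L) (ι : Act nΣ → L) → Fin (nS A) → Fin (nS A) → Set
TauStar A ι = Star (Step A (ι tau))

WeakAct : {nΣ : ℕ} {L : Set} (A : TS L) (ι : Act nΣ → L) → Act nΣ → Fin (nS A) → Fin (nS A) → Set
WeakAct A ι tau     s t = TauStar A ι s t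
WeakAct A ι (act a) s t =
  Σ (Fin (nS A)) λ u → Σ (Fin (nS A)) λ v →
    TauStar A ι s u × Step A (ι (act a)) u v × TauStar A ι v t

WeakA : {nΣ : ℕ} (A : TS (Act nΣ)) → Act nΣ → Fin (nS A) → Fin (nS A) → Set
WeakA A = WeakAct A (λ e → e)

WeakA' : {nΣ nF : ℕ} (A' : TS (FLab nΣ nF)) → FLab nΣ nF → Fin (nS A') → Fin (nS A') → Set
WeakA' A' (ord e) = WeakAct A' ord e
WeakA' A' (flt f) = Step A' (flt f)

-- M-transitions of A^M: A^M is A with an added self-loop s --M--> s at
-- every state (and A has no M-transitions), so  s --M--> t  iff  t ≡ s.
-- For M, ⇒M = →M.
MStep : {nΣ : ℕ} (A : TS (Act nΣ)) → Fin (nS A) → Fin (nS A) → Set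
MStep A s t = t ≡ s

record IsWeakMaskingSim {nΣ nF : ℕ} (A : TS (Act nΣ)) (A' : TS (FLab nΣ nF))
       (M : Fin (nS A) → Fin (nS A') → Set) : Set where
  field
    init  : M (s₀ A) (s₀ A')
    cond1 : ∀ s s' → M s s' → (e : Act nΣ) (t : Fin (nS A)) → Step A e s t →
            Σ (Fin (nS A')) λ t' → WeakA' A' (ord e) s' t' × M t t'
    cond2 : ∀ s s' → M s s' → (e : Act nΣ) (t' : Fin (nS A')) → Step A' (ord e) s' t' →
            Σ (Fin (nS A)) λ t → WeakA A e s t × M t t'
    cond3 : ∀ s s' → M s s' → (F : Fin nF) (t' : Fin (nS A')) → Step A' (flt F) s' t' →
            Σ (Fin (nS A)) λ t → MStep A s t × M t t'

WeakMaskingSim : {nΣ nF : ℕ} (A : TS (Act nΣ)) (A' : TS (FLab nΣ nF)) → Set₁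
WeakMaskingSim A A' = Σ (Fin (nS A) → Fin (nS A') → Set) λ M → IsWeakMaskingSim A A' M

module MaskingGame {nΣ nF : ℕ} (A : TS (Act nΣ)) (A' : TS (FLab nΣ nF)) where

  S  = Fin (nS A)
  S' = Fin (nS A')

  -- nodes: (s,#,s',R), (s,σ¹,s',V) with σ ∈ Σ∪{τ}, (s,σ²,s',V) with σ ∈ Σ_F∪{τ}, s_err
  data Node : Set where
    R   : S → S' → Node
    V1  : S → Act nΣ → S' → Node
    V2  : S → FLab nΣ nF → S' → Node
    err : Node

  -- edge labels: σ ∈ Σ_F ∪ {τ}, the masking label M, and a label for the
  -- added edges into s_err (the paper leaves that label unspecified)
  data GLab : Set where
    lab    : FLab nΣ nF → GLab
    mask   : GLab
    errLab : GLab

  initial : Node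
  initial = R (s₀ A) (s₀ A')

  data BaseEdge : Node → GLab → Node → Set where
    r1 : ∀ {s s' t} (σ : Act nΣ) → WeakA A σ s t →
         BaseEdge (R s s') (lab (ord σ)) (V1 t σ s')
    r2 : ∀ {s s' t'} (σ : FLab nΣ nF) → WeakA' A' σ s' t' →
         BaseEdge (R s s') (lab σ) (V2 s σ t')
    v2 : ∀ {s s' t} (σ : Act nΣ) → WeakA A σ s t →
         BaseEdge (V2 s (ord σ) s') (lab (ord σ)) (R t s')
    v1 : ∀ {s s' t'} (σ : Act nΣ) → WeakA' A' (ord σ) s' t' →
         BaseEdge (V1 s σ s') (lab (ord σ)) (R s t')
    vF : ∀ {s s' t} (F : Fin nF) → MStep A s t →
         BaseEdge (V2 s (flt F) s') mask (R t s')

  HasBaseEdge : Node → Set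
  HasBaseEdge n = Σ GLab λ l → Σ Node λ m → BaseEdge n l m

  -- every node without outgoing edges gets an edge to s_err
  -- (in particular s_err gets its self-loop)
  data Edge : Node → GLab → Node → Set where
    base   : ∀ {n l m} → BaseEdge n l m → Edge n l m
    toErr  : ∀ {n} → ¬ HasBaseEdge n → Edge n errLab err

  data IsV : Node → Set where
    isV1 : ∀ {s σ s'} → IsV (V1 s σ s')
    isV2 : ∀ {s σ s'} → IsV (V2 s σ s')

  data Path : Node → Set where
    start : Path initial
    step  : ∀ {n l m} → Path n → Edge n l m → Path m

  VStrategy : Set
  VStrategy = ∀ {n} → Path n → IsV n → Σ GLab λ l → Σ Node λ m → Edge n l m

  record Play : Set where
    field
      node  : ℕ → Node
      label : ℕ → GLab
      first : node 0 ≡ initial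
      edge  : (i : ℕ) → Edge (node i) (label i) (node (suc i))

  open Play public

  prefix : (p : Play) (i : ℕ) → Path (node p i)
  prefix p zero    = subst Path (sym (first p)) start
  prefix p (suc i) = step (prefix p i) (edge p i)

  ConformsTo : Play → VStrategy → Set
  ConformsTo p σ = (i : ℕ) (v : IsV (node p i)) →
    proj₁ (σ (prefix p i) v) ≡ label p i × proj₁ (proj₂ (σ (prefix p i) v)) ≡ node p (suc i)

  RefuterWinsPlay : Play → Set
  RefuterWinsPlay p = Σ ℕ λ i → node p i ≡ err

  VerifierWinning : VStrategy → Set
  VerifierWinning σ = (p : Play) → ConformsTo p σ → ¬ RefuterWinsPlay p

  VerifierHasWinningStrategy : Set
  VerifierHasWinningStrategy = Σ VStrategy VerifierWinning

VerifierWinsWeakMaskingGame : {nΣ nF : ℕ} (A : TS (Act nΣ)) (A' : TS (FLab nΣ nF)) → Set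
VerifierWinsWeakMaskingGame A A' = MaskingGame.VerifierHasWinningStrategy A A'

module Submission where

-- (⇒) Given a weak masking simulation M, the verifier keeps track, along
--     the history of the play, of a proof that the current position is
--     "covered" by M: refuter nodes (s,#,s') with M s s', and verifier
--     nodes reached from such a pair by one refuter move.  Since M lifts
--     single steps to weak steps (match-weak), every covered
--     verifier node has a reply leading back to a pair in M.  Playing
--     these replies keeps every conforming play covered, and s_err is
--     never covered.
-- (⇐) Given a winning verifier strategy σ, let M be the set of pairs
--     (s,s') such that (s,#,s') occurs in some play where the refuter
--     follows a time-dependent positional strategy and the verifier
--     follows σ.  A refuter move from such a pair can be forced by
--     deviating the refuter strategy at that time; σ's answer is not an
--     error move since σ is winning, which gives the simulation clauses.
-- Both directions need the completed game graph to be total, i.e. that it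
-- is decidable whether a node has an edge; this reduces to decidability
-- of weak visible steps, a reachability question in a finite graph, which
-- is settled first (module FiniteReachability).

open import Defs
open import Data.Nat as ℕ using (ℕ; zero; suc; _≤_; s≤s)
open import Data.Nat.Properties using (≤-refl; ≤-trans; n≤1+n; <⇒≢)
open import Data.Fin using (Fin; zero; suc; _≟_)
open import Data.Fin.Properties using (any?; injective⇒≤)
open import Data.Bool using (true)
import Data.Bool.Properties as Bool
open import Data.List using (List; []; _∷_; length; lookup)
open import Data.List.Membership.Propositional using (_∈_)
open import Data.List.Membership.Propositional.Properties using (∈-lookup)
import Data.List.Relation.Unary.All as All
open import Data.List.Relation.Unary.All.Properties using (¬Any⇒All¬)
open import Data.List.Relation.Unary.Any using (here; there)
import Data.List.Relation.Unary.Any as Any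
open import Data.List.Relation.Unary.Unique.Propositional using (Unique; []; _∷_)
open import Data.Maybe using (Maybe; just; nothing)
open import Data.Product using (Σ; _×_; _,_; proj₁; proj₂)
open import Data.Sum using (_⊎_; inj₁; inj₂)
open import Data.Empty using (⊥; ⊥-elim)
open import Function using (flip)
open import Function.Definitions using (Injective)
open import Relation.Nullary using (Dec; yes; no)
open import Relation.Nullary.Decidable using (map′; _×-dec_; _⊎-dec_)
open import Relation.Binary.PropositionalEquality
open import Relation.Binary.Construct.Closure.ReflexiveTransitive using (Star; ε; _◅_; _◅◅_)

lookup-injective : {X : Set} {xs : List X} → Unique xs → Injective _≡_ _≡_ (lookup xs)
lookup-injective {xs = _ ∷ _} (_ ∷ _)      {zero}  {zero}  _  = refl
lookup-injective {xs = _ ∷ _} (x∉xs ∷ _)   {zero}  {suc j} eq = ⊥-elim (All.lookup x∉xs (∈-lookup j) eq)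
lookup-injective {xs = _ ∷ _} (x∉xs ∷ _)   {suc i} {zero}  eq = ⊥-elim (All.lookup x∉xs (∈-lookup i) (sym eq))
lookup-injective {xs = _ ∷ _} (_ ∷ unique) {suc i} {suc j} eq = cong suc (lookup-injective unique eq)

unique⇒length≤ : {n : ℕ} {xs : List (Fin n)} → Unique xs → length xs ≤ n
unique⇒length≤ unique = injective⇒≤ (lookup-injective unique)

module FiniteReachability {n : ℕ} (T : Fin n → Fin n → Set) (T? : ∀ x y → Dec (T x y)) where

  -- A walk from s to u visiting exactly the states listed (u excluded).
  data Walk : Fin n → Fin n → List (Fin n) → Set where
    []  : ∀ {u} → Walk u u []
    _∷_ : ∀ {s v u vs} → T s v → Walk v u vs → Walk s u (s ∷ vs)

  walkFrom : ∀ {x s u vs} → x ∈ vs → Walk s u vs → Unique vs →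
             Σ (List (Fin n)) λ ws → Walk x u ws × Unique ws
  walkFrom (here refl) (t ∷ walk)  unique       = _ , t ∷ walk , unique
  walkFrom (there x∈)  (_ ∷ walk)  (_ ∷ unique) = walkFrom x∈ walk unique

  simpleWalk : ∀ {s u} → Star T s u → Σ (List (Fin n)) λ vs → Walk s u vs × Unique vs
  simpleWalk ε = [] , [] , []
  simpleWalk {s} (t ◅ path) with simpleWalk path
  ... | vs , walk , unique with Any.any? (s ≟_) vs
  ...   | yes s∈vs = walkFrom s∈vs walk unique
  ...   | no  s∉vs = s ∷ vs , t ∷ walk , ¬Any⇒All¬ vs s∉vs ∷ unique

  module _ (P : Fin n → Set) (P? : ∀ x → Dec (P x)) where

    Reaches : Fin n → Set
    Reaches s = Σ (Fin n) λ u → Star T s u × P u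

    ReachesWithin : ℕ → Fin n → Set
    ReachesWithin zero    s = P s
    ReachesWithin (suc k) s = P s ⊎ Σ (Fin n) λ v → T s v × ReachesWithin k v

    reachesWithin? : ∀ k s → Dec (ReachesWithin k s)
    reachesWithin? zero    s = P? s
    reachesWithin? (suc k) s = P? s ⊎-dec any? (λ v → T? s v ×-dec reachesWithin? k v)

    within⇒reaches : ∀ k s → ReachesWithin k s → Reaches s
    within⇒reaches zero    s p        = s , ε , p
    within⇒reaches (suc k) s (inj₁ p) = s , ε , p
    within⇒reaches (suc k) s (inj₂ (v , t , within)) =
      let (u , path , p) = within⇒reaches k v within in u , t ◅ path , p

    reachesWithin-here : ∀ k {s} → P s → ReachesWithin k s
    reachesWithin-here zero    p = p
    reachesWithin-here (suc k) p = inj₁ p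

    walk⇒within : ∀ k {s u vs} → Walk s u vs → length vs ≤ k → P u → ReachesWithin k s
    walk⇒within k       []          _         p = reachesWithin-here k p
    walk⇒within (suc k) (t ∷ walk) (s≤s len) p = inj₂ (_ , t , walk⇒within k walk len p)

    -- It suffices to search walks of length at most n.
    reaches? : ∀ s → Dec (Reaches s)
    reaches? s = map′ (within⇒reaches n s) bounded (reachesWithin? n s)
      where
      bounded : Reaches s → ReachesWithin n s
      bounded (u , path , p) =
        let (vs , walk , unique) = simpleWalk path in walk⇒within n walk (unique⇒length≤ unique) p

weakVisible? : {nΣ : ℕ} {L : Set} (X : TS L) (ι : Act nΣ → L) (a : Fin nΣ) (s : Fin (nS X)) →
               Dec (Σ (Fin (nS X)) λ t → WeakAct X ι (act a) s t)
weakVisible? X ι a s =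
  map′ (λ { (u , path , v , t) → v , u , v , path , t , ε })
       (λ { (_ , u , v , path , t , _) → u , path , v , t })
       (reaches? (λ u → Σ (Fin (nS X)) λ v → Step X (ι (act a)) u v)
                 (λ u → any? (λ v → E X u (ι (act a)) v Bool.≟ true)) s)
  where open FiniteReachability (Step X (ι tau)) (λ x y → E X x (ι tau) y Bool.≟ true)

strong⇒weak : {nΣ : ℕ} {L : Set} (X : TS L) (ι : Act nΣ → L) (e : Act nΣ) {s t : Fin (nS X)} →
              Step X (ι e) s t → WeakAct X ι e s t
strong⇒weak X ι tau     t = t ◅ ε
strong⇒weak X ι (act a) t = _ , _ , ε , t , ε

weak-τ-pad : {nΣ : ℕ} {L : Set} (X : TS L) (ι : Act nΣ → L) (e : Act nΣ) {s u v t : Fin (nS X)} →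
             TauStar X ι s u → WeakAct X ι e u v → TauStar X ι v t → WeakAct X ι e s t
weak-τ-pad X ι tau     before w after = before ◅◅ w ◅◅ after
weak-τ-pad X ι (act a) before (u , v , τ₁ , t , τ₂) after = u , v , before ◅◅ τ₁ , t , τ₂ ◅◅ after

module WeakMatching {nΣ : ℕ} {L L' : Set} (X : TS L) (ιX : Act nΣ → L) (Y : TS L') (ιY : Act nΣ → L')
         (M : Fin (nS X) → Fin (nS Y) → Set)
         (match : ∀ {x y x'} (e : Act nΣ) → M x y → Step X (ιX e) x x' →
                  Σ (Fin (nS Y)) λ y' → WeakAct Y ιY e y y' × M x' y') where

  match-τ* : ∀ {x y x'} → M x y → TauStar X ιX x x' →
             Σ (Fin (nS Y)) λ y' → TauStar Y ιY y y' × M x' y'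
  match-τ* m ε = _ , ε , m
  match-τ* m (t ◅ path) =
    let (y₁ , w₁ , m₁) = match tau m t
        (y₂ , w₂ , m₂) = match-τ* m₁ path
    in y₂ , w₁ ◅◅ w₂ , m₂

  match-weak : ∀ {x y x'} (e : Act nΣ) → M x y → WeakAct X ιX e x x' →
               Σ (Fin (nS Y)) λ y' → WeakAct Y ιY e y y' × M x' y'
  match-weak tau     m path = match-τ* m path
  match-weak (act a) m (_ , _ , τ₁ , t , τ₂) =
    let (y₁ , w₁ , m₁) = match-τ* m τ₁
        (y₂ , w₂ , m₂) = match (act a) m₁ t
        (y₃ , w₃ , m₃) = match-τ* m₂ τ₂
    in y₃ , weak-τ-pad Y ιY (act a) w₁ w₂ w₃ , m₃

module _ {nΣ nF : ℕ} (A : TS (Act nΣ)) (A' : TS (FLab nΣ nF)) where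
  open MaskingGame A A'

  Move : Node → Set
  Move n = Σ GLab λ l → Σ Node λ m → Edge n l m

  hasBaseEdge? : (n : Node) → Dec (HasBaseEdge n)
  hasBaseEdge? (R s s')            = yes (_ , _ , r1 tau ε)
  hasBaseEdge? (V1 t tau s')       = yes (_ , _ , v1 tau ε)
  hasBaseEdge? (V1 t (act a) s')   =
    map′ (λ (_ , w) → _ , _ , v1 (act a) w) (λ { (_ , _ , v1 _ w) → _ , w }) (weakVisible? A' ord a s')
  hasBaseEdge? (V2 s (ord tau) t') = yes (_ , _ , v2 tau ε)
  hasBaseEdge? (V2 s (ord (act a)) t') =
    map′ (λ (_ , w) → _ , _ , v2 (act a) w) (λ { (_ , _ , v2 _ w) → _ , w }) (weakVisible? A (λ e → e) a s)
  hasBaseEdge? (V2 s (flt F) t')   = yes (_ , _ , vF F refl)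
  hasBaseEdge? err                 = no λ { (_ , _ , ()) }

  successor : (n : Node) → Move n
  successor n with hasBaseEdge? n
  ... | yes (l , m , b) = l , m , base b
  ... | no  none        = errLab , err , toErr none

  module VerifierFromSimulation (M : S → S' → Set) (sim : IsWeakMaskingSim A A' M) where
    open IsWeakMaskingSim sim

    forth : ∀ {s s' t} (e : Act nΣ) → M s s' → WeakA A e s t → Σ S' λ t' → WeakA' A' (ord e) s' t' × M t t'
    forth = WeakMatching.match-weak A (λ e → e) A' ord M (λ e m t → cond1 _ _ m e _ t)

    back : ∀ {s s' t'} (e : Act nΣ) → M s s' → WeakA' A' (ord e) s' t' → Σ S λ t → WeakA A e s t × M t t'
    back = WeakMatching.match-weak A' ord A (λ e → e) (flip M) (λ e m t → cond2 _ _ m e _ t)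

    Covered : Node → Set
    Covered (R s s')    = M s s'
    Covered (V1 t σ s') = Σ S λ s → M s s' × WeakA A σ s t
    Covered (V2 s σ t') = Σ S' λ s' → M s s' × WeakA' A' σ s' t'
    Covered err         = ⊥

    Reply : Node → Set
    Reply n = Σ S λ t → Σ S' λ t' → M t t' × Σ GLab λ l → BaseEdge n l (R t t')

    reply : ∀ {n} → Covered n → IsV n → Reply n
    reply {V1 t σ s'} (_ , m , w) isV1 =
      let (t' , w' , m') = forth σ m w in t , t' , m' , _ , v1 σ w'
    reply {V2 s (ord σ) t'} (_ , m , w) isV2 =
      let (t , w' , m') = back σ m w in t , t' , m' , _ , v2 σ w'
    reply {V2 s (flt F) t'} (s' , m , w) isV2 =
      let (t , masked , m') = cond3 s s' m F t' w in t , t' , m' , _ , vF F masked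

    replyMove : ∀ {n} → Reply n → Move n
    replyMove (t , t' , _ , l , b) = l , R t t' , base b

    coveredIfReplied : ∀ {n} → Reply n → (m : Node) → Maybe (Covered m)
    coveredIfReplied (t , t' , m , _) (R x x') with x ≟ t | x' ≟ t'
    ... | yes refl | yes refl = just m
    ... | _        | _        = nothing
    coveredIfReplied _ _ = nothing

    coveredIfReplied-target : ∀ {n} (r : Reply n) → Σ (Covered (proj₁ (proj₂ (replyMove r)))) λ c →
                              coveredIfReplied r (proj₁ (proj₂ (replyMove r))) ≡ just c
    coveredIfReplied-target (t , t' , m , _) with t ≟ t | t' ≟ t'
    ... | yes refl | yes refl = m , refl
    ... | no t≢t   | _        = ⊥-elim (t≢t refl)
    ... | yes _    | no t'≢t' = ⊥-elim (t'≢t' refl)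

    -- What the verifier knows after one more edge: refuter moves from a
    -- covered pair are covered; after a verifier node only the own reply is.
    -- (Coverage is a proof, not a decidable property, hence this bookkeeping.)
    advance : ∀ {n l m} → Maybe (Covered n) → Edge n l m → Maybe (Covered m)
    advance nothing _ = nothing
    advance {R s s'} (just c) (base (r1 σ w)) = just (s , c , w)
    advance {R s s'} (just c) (base (r2 σ w)) = just (s' , c , w)
    advance {R s s'} (just c) (toErr _)       = nothing
    advance {n@(V1 _ _ _)} {m = m} (just c) _ = coveredIfReplied (reply {n} c isV1) m
    advance {n@(V2 _ _ _)} {m = m} (just c) _ = coveredIfReplied (reply {n} c isV2) m

    knowledge : ∀ {n} → Path n → Maybe (Covered n)
    knowledge start      = just init
    knowledge (step q e) = advance (knowledge q) e

    respond : ∀ {n} → Maybe (Covered n) → IsV n → Move n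
    respond (just c) v = replyMove (reply c v)
    respond nothing  v = successor _

    strategy : VStrategy
    strategy q v = respond (knowledge q) v

    preserved : ∀ {n l m} (k : Maybe (Covered n)) (c : Covered n) → k ≡ just c → (e : Edge n l m) →
                ((v : IsV n) → proj₁ (proj₂ (respond k v)) ≡ m) →
                Σ (Covered m) λ c' → advance k e ≡ just c'
    preserved {R s s'} _ c refl (base (r1 σ w)) _ = _ , refl
    preserved {R s s'} _ c refl (base (r2 σ w)) _ = _ , refl
    preserved {R s s'} _ c refl (toErr none)    _ = ⊥-elim (none (_ , _ , r1 tau ε))
    preserved {n@(V1 _ _ _)} _ c refl _ follows
      rewrite sym (follows isV1) = coveredIfReplied-target (reply {n} c isV1)
    preserved {n@(V2 _ _ _)} _ c refl _ follows
      rewrite sym (follows isV2) = coveredIfReplied-target (reply {n} c isV2)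

    initially : ∀ {n} (eq : n ≡ initial) → Σ (Covered n) λ c → knowledge (subst Path (sym eq) start) ≡ just c
    initially refl = init , refl

    always-covered : (p : Play) → ConformsTo p strategy → (i : ℕ) →
                     Σ (Covered (node p i)) λ c → knowledge (prefix p i) ≡ just c
    always-covered p conforms zero    = initially (first p)
    always-covered p conforms (suc i) =
      let (c , known) = always-covered p conforms i
      in preserved (knowledge (prefix p i)) c known (edge p i) (λ v → proj₂ (conforms i v))

    winning : VerifierWinning strategy
    winning p conforms (i , at-err) = subst Covered at-err (proj₁ (always-covered p conforms i))

  module SimulationFromVerifier (σ : VStrategy) (win : VerifierWinning σ) where

    RStrategy : Set
    RStrategy = ℕ → (s : S) (s' : S') → Move (R s s')

    move : RStrategy → ℕ → (n : Node) → Path n → Move n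
    move ρ j (R s s')   q = ρ j s s'
    move ρ j (V1 _ _ _) q = σ q isV1
    move ρ j (V2 _ _ _) q = σ q isV2
    move ρ j err        q = successor err

    extend : (x : Σ Node Path) → Move (proj₁ x) → Σ Node Path
    extend (_ , q) (_ , m , e) = m , step q e

    history : RStrategy → ℕ → Σ Node Path
    history ρ zero    = initial , start
    history ρ (suc j) = extend (history ρ j) (move ρ j (proj₁ (history ρ j)) (proj₂ (history ρ j)))

    position : RStrategy → ℕ → Node
    position ρ j = proj₁ (history ρ j)

    outcome : RStrategy → Play
    outcome ρ = record
      { node  = position ρ
      ; label = λ j → proj₁ (move ρ j (position ρ j) (proj₂ (history ρ j)))
      ; first = refl
      ; edge  = λ j → proj₂ (proj₂ (move ρ j (position ρ j) (proj₂ (history ρ j))))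
      }

    prefix-outcome : ∀ ρ j → prefix (outcome ρ) j ≡ proj₂ (history ρ j)
    prefix-outcome ρ zero    = refl
    prefix-outcome ρ (suc j) = cong (λ q → step q (edge (outcome ρ) j)) (prefix-outcome ρ j)

    outcome-conforms : ∀ ρ → ConformsTo (outcome ρ) σ
    outcome-conforms ρ i v rewrite prefix-outcome ρ i with position ρ i | proj₂ (history ρ i) | v
    ... | _ | _ | isV1 = refl , refl
    ... | _ | _ | isV2 = refl , refl

    outcome-safe : ∀ ρ j → position ρ j ≢ err
    outcome-safe ρ j at-err = win (outcome ρ) (outcome-conforms ρ) (j , at-err)

    Visited : S → S' → Set
    Visited s s' = Σ RStrategy λ ρ → Σ ℕ λ j → position ρ j ≡ R s s'

    deviate : RStrategy → ℕ → (s : S) (s' : S') → Move (R s s') → RStrategy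
    deviate ρ i s s' c j x x' with j ℕ.≟ i | x ≟ s | x' ≟ s'
    ... | yes _ | yes refl | yes refl = c
    ... | _     | _        | _        = ρ j x x'

    deviate-elsewhere : ∀ ρ i s s' c j x x' → j ≢ i → deviate ρ i s s' c j x x' ≡ ρ j x x'
    deviate-elsewhere ρ i s s' c j x x' j≢i with j ℕ.≟ i | x ≟ s | x' ≟ s'
    ... | yes j≡i | _ | _ = ⊥-elim (j≢i j≡i)
    ... | no _    | _ | _ = refl

    deviate-here : ∀ ρ i s s' c → deviate ρ i s s' c i s s' ≡ c
    deviate-here ρ i s s' c with i ℕ.≟ i | s ≟ s | s' ≟ s'
    ... | yes _ | yes refl | yes refl = refl
    ... | no i≢i | _       | _        = ⊥-elim (i≢i refl)
    ... | yes _  | no s≢s  | _        = ⊥-elim (s≢s refl)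
    ... | yes _  | yes _   | no s'≢s' = ⊥-elim (s'≢s' refl)

    deviate-history : ∀ ρ i s s' c j → j ≤ i → history (deviate ρ i s s' c) j ≡ history ρ j
    deviate-history ρ i s s' c zero    _      = refl
    deviate-history ρ i s s' c (suc j) j<i
      rewrite deviate-history ρ i s s' c j (≤-trans (n≤1+n j) j<i) = cong (extend (history ρ j)) same-move
      where
      same-move : move (deviate ρ i s s' c) j (position ρ j) (proj₂ (history ρ j)) ≡
                  move ρ j (position ρ j) (proj₂ (history ρ j))
      same-move with position ρ j | proj₂ (history ρ j)
      ... | R x x'     | _ = deviate-elsewhere ρ i s s' c j x x' (<⇒≢ j<i)
      ... | V1 _ _ _   | _ = refl
      ... | V2 _ _ _   | _ = refl
      ... | err        | _ = refl

    force : ∀ {s s'} → Visited s s' → (c : Move (R s s')) →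
            Σ RStrategy λ ρ → Σ ℕ λ j → position ρ j ≡ proj₁ (proj₂ c)
    force {s} {s'} (ρ , i , at) c = ρ' , suc i , forced
      where
      ρ' = deviate ρ i s s' c
      deviated-step : (x : Σ Node Path) → proj₁ x ≡ R s s' →
                      proj₁ (extend x (move ρ' i (proj₁ x) (proj₂ x))) ≡ proj₁ (proj₂ c)
      deviated-step (_ , _) refl = cong (λ d → proj₁ (proj₂ d)) (deviate-here ρ i s s' c)
      forced : position ρ' (suc i) ≡ proj₁ (proj₂ c)
      forced = deviated-step (history ρ' i) (trans (cong proj₁ (deviate-history ρ i s s' c i ≤-refl)) at)

    -- σ's answer to a forced move is an edge of the base graph, since it
    -- does not enter s_err.
    answer : ∀ {s s'} → Visited s s' → (c : Move (R s s')) →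
             Σ RStrategy λ ρ → Σ ℕ λ j → position ρ j ≡ proj₁ (proj₂ c) ×
             Σ GLab λ l → BaseEdge (position ρ j) l (position ρ (suc j))
    answer visited c =
      let (ρ , j , at) = force visited c in
      ρ , j , at , _ , toBase (edge (outcome ρ) j) (outcome-safe ρ (suc j))
      where
      toBase : ∀ {n l m} → Edge n l m → m ≢ err → BaseEdge n l m
      toBase (base b)  _      = b
      toBase (toErr _) m≢err  = ⊥-elim (m≢err refl)

    after-V1 : ∀ {n l m t e s'} → n ≡ V1 t e s' → BaseEdge n l m →
               Σ S' λ t' → WeakA' A' (ord e) s' t' × m ≡ R t t'
    after-V1 refl (v1 _ w) = _ , w , refl

    after-V2 : ∀ {n l m s e t'} → n ≡ V2 s (ord e) t' → BaseEdge n l m →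
               Σ S λ t → WeakA A e s t × m ≡ R t t'
    after-V2 refl (v2 _ w) = _ , w , refl

    after-V2-fault : ∀ {n l m s F t'} → n ≡ V2 s (flt F) t' → BaseEdge n l m →
                     Σ S λ t → MStep A s t × m ≡ R t t'
    after-V2-fault refl (vF _ masked) = _ , masked , refl

    -- Visited is a weak masking simulation: each clause forces the
    -- refuter move matching the given step and reads off σ's answer.
    visited-sim : IsWeakMaskingSim A A' Visited
    visited-sim = record
      { init  = (λ j s s' → successor (R s s')) , zero , refl
      ; cond1 = λ s s' visited e t step →
          let (ρ , j , at , _ , b) = answer visited (_ , _ , base (r1 e (strong⇒weak A (λ e → e) e step)))
              (t' , w , next) = after-V1 at b
          in t' , w , ρ , suc j , next
      ; cond2 = λ s s' visited e t' step →
          let (ρ , j , at , _ , b) = answer visited (_ , _ , base (r2 (ord e) (strong⇒weak A' ord e step)))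
              (t , w , next) = after-V2 at b
          in t , w , ρ , suc j , next
      ; cond3 = λ s s' visited F t' step →
          let (ρ , j , at , _ , b) = answer visited (_ , _ , base (r2 (flt F) step))
              (t , masked , next) = after-V2-fault at b
          in t , masked , ρ , suc j , next
      }

theorem4 : {nΣ nF : ℕ} (A : TS (Act nΣ)) (A' : TS (FLab nΣ nF)) →
    (WeakMaskingSim A A' → VerifierWinsWeakMaskingGame A A') ×
    (VerifierWinsWeakMaskingGame A A' → WeakMaskingSim A A')
theorem4 A A' = sim⇒win , win⇒sim
  where
  sim⇒win : WeakMaskingSim A A' → VerifierWinsWeakMaskingGame A A'
  sim⇒win (M , sim) = strategy , winning
    where open VerifierFromSimulation A A' M sim

  win⇒sim : VerifierWinsWeakMaskingGame A A' → WeakMaskingSim A A'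
  win⇒sim (σ , win) = Visited , visited-sim
    where open SimulationFromVerifier A A' σ win
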